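{- Let $\Omega$ be a set, $\mathcal Q$ a second-order structure on $\Omega$, and $Q$ a first-order relation (of finite arity) or a finite second-order relation on $\Omega$. If $Q\in\mathrm{Inv}(\mathrm{Aut}(\mathcal Q))$, then $Q$ is definable in $\mathscr{L}_{\infty\infty}(\mathcal Q)$.
   Context: A (finite) second-order relation of type $(i_1,\dots,i_k)$ on $\Omega$ ($k,i_j$ finite) is a subset of $\mathcal P(\Omega^{i_1})\times\dots\times\mathcal P(\Omega^{i_k})$. A second-order structure on $\Omega$ is a set of first-order relations of finite arity and second-order relations on $\Omega$. A permutation $g$ preserves a first-order relation $R$ if $gR=R$, and preserves a second-order relation $Q$ of type $(i_1,\dots,i_k)$ if for all $R_j\subseteq\Omega^{i_j}$: $(R_1,\dots,R_k)\in Q$ iff $(gR_1,\dots,gR_k)\in Q$. $\mathrm{Aut}(\mathcal Q)$ is the group of permutations of $\Omega$ preserving every member of $\mathcal Q$; for a set $H$ of permutations, $\mathrm{Inv}(H)$ is the set of first-order and second-order relations on $\Omega$ preserved by all $h\in H$. $\mathscr{L}_{\infty\infty}(\mathcal Q)$ is the infinitary logic with equality (arbitrary conjunctions and disjunctions, quantification over arbitrarily long sequences of variables) with a predicate symbol for each first-order relation of $\mathcal Q$ and a generalized quantifier symbol for each second-order $Q'\in\mathcal Q$ of type $(i_1,\dots,i_k)$: $Q'\bar x_1\dots\bar x_k(\varphi_1,\dots,\varphi_k)$ holds iff $(\|\varphi_1\|,\dots,\|\varphi_k\|)\in Q'$, where $\|\varphi_j\|\subseteq\Omega^{i_j}$ is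 the set of tuples satisfying $\varphi_j$ in the bound variables $\bar x_j$. A second-order relation $Q$ of type $(i_1,\dots,i_k)$ is definable if there is a sentence $\varphi(P_1,\dots,P_k)$ of $\mathscr{L}_{\infty\infty}(\mathcal Q)$ expanded with new predicate symbols $P_j$ of arity $i_j$ such that $\Omega,\mathcal Q,R_1,\dots,R_k\models\varphi$ iff $(R_1,\dots,R_k)\in Q$; a first-order relation $R\subseteq\Omega^n$ is definable if some formula $\varphi(x_1,\dots,x_n)$ satisfies $\Omega,\mathcal Q\models\varphi(\bar a)$ iff $\bar a\in R$. -}

module Defs where

open import Level using (Level; suc; Lift; lift)
open import Data.Nat using (ℕ)
open import Data.Fin using (Fin)
open import Data.Bool using (Bool; true)
open import Data.Vec using (Vec; map; lookup)
open import Data.Sum using (_⊎_; inj₁; inj₂; [_,_])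
open import Data.Product using (Σ)
open import Data.Empty.Polymorphic using (⊥)
open import Relation.Nullary using (Dec; ¬_)
open import Relation.Nullary.Decidable using (⌊_⌋)
open import Relation.Binary.PropositionalEquality using (_≡_)
open import Function.Bundles using (_↔_; _⇔_; Inverse)

private
  variable
    ℓ : Level

-- Subsets are
-- represented by characteristic functions into Bool, and the semantics of
-- generalized quantifiers (which must turn the extension of a formula into
-- a subset) uses excluded middle, taken as an explicit hypothesis.

LEM : (ℓ : Level) → Set (suc ℓ)
LEM ℓ = (P : Set ℓ) → Dec P

Subset : Set ℓ → ℕ → Set ℓ
Subset Ω n = Vec Ω n → Bool

-- Being a set of tuples of
-- SETS, membership respects extensional equality of the R_j.
record SORel (Ω : Set ℓ) (k : ℕ) (t : Fin k → ℕ) : Set ℓ where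
  field
    rel : ((j : Fin k) → Subset Ω (t j)) → Bool
    ext : (S S′ : (j : Fin k) → Subset Ω (t j)) →
          ((j : Fin k) (xs : Vec Ω (t j)) → S j xs ≡ S′ j xs) →
          rel S ≡ rel S′
open SORel public

record Signature (ℓ : Level) : Set (suc ℓ) where
  field
    FSym : Set ℓ
    far  : FSym → ℕ
    QSym : Set ℓ
    qk   : QSym → ℕ
    qt   : (q : QSym) → Fin (qk q) → ℕ
open Signature public

record Structure (Ω : Set ℓ) : Set (suc ℓ) where
  field
    sig  : Signature ℓ
    fint : (r : FSym sig) → Subset Ω (far sig r)
    qint : (q : QSym sig) → SORel Ω (qk sig q) (qt sig q)
open Structure public

data Formula (σ : Signature ℓ) (V : Set ℓ) : Set (suc ℓ) where
  eq   : V → V → Formula σ V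
  atom : (r : FSym σ) → Vec V (far σ r) → Formula σ V
  gq   : (q : QSym σ) →
         ((j : Fin (qk σ q)) → Formula σ (V ⊎ Fin (qt σ q j))) → Formula σ V
  neg  : Formula σ V → Formula σ V
  conj : (I : Set ℓ) → (I → Formula σ V) → Formula σ V
  disj : (I : Set ℓ) → (I → Formula σ V) → Formula σ V
  ex   : (J : Set ℓ) → Formula σ (V ⊎ J) → Formula σ V
  all  : (J : Set ℓ) → Formula σ (V ⊎ J) → Formula σ V

Sat : {ℓ : Level} → LEM ℓ → {Ω : Set ℓ} (𝒬 : Structure Ω) {V : Set ℓ} →
      Formula (sig 𝒬) V → (V → Ω) → Set ℓ
Sat lem 𝒬 (eq x y)     ρ = ρ x ≡ ρ y
Sat {ℓ} lem 𝒬 (atom r xs)  ρ = Lift ℓ (fint 𝒬 r (map ρ xs) ≡ true)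
Sat {ℓ} lem 𝒬 (gq q φs)    ρ = Lift ℓ
  (rel (qint 𝒬 q) (λ j as → ⌊ lem (Sat lem 𝒬 (φs j) [ ρ , lookup as ]) ⌋) ≡ true)
Sat lem 𝒬 (neg φ)      ρ = ¬ Sat lem 𝒬 φ ρ
Sat lem 𝒬 (conj I φs)  ρ = (i : I) → Sat lem 𝒬 (φs i) ρ
Sat lem 𝒬 (disj I φs)  ρ = Σ I (λ i → Sat lem 𝒬 (φs i) ρ)
Sat lem {Ω} 𝒬 (ex J φ) ρ = Σ (J → Ω) (λ τ → Sat lem 𝒬 φ [ ρ , τ ])
Sat lem {Ω} 𝒬 (all J φ) ρ = (τ : J → Ω) → Sat lem 𝒬 φ [ ρ , τ ]

expandSig : (σ : Signature ℓ) (k : ℕ) (t : Fin k → ℕ) → Signature ℓ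
expandSig {ℓ} σ k t = record
  { FSym = FSym σ ⊎ Lift ℓ (Fin k)
  ; far  = λ { (inj₁ r) → far σ r ; (inj₂ (lift j)) → t j }
  ; QSym = QSym σ
  ; qk   = qk σ
  ; qt   = qt σ
  }

expand : {Ω : Set ℓ} (𝒬 : Structure Ω) (k : ℕ) (t : Fin k → ℕ) →
         ((j : Fin k) → Subset Ω (t j)) → Structure Ω
expand 𝒬 k t R = record
  { sig  = expandSig (sig 𝒬) k t
  ; fint = λ { (inj₁ r) → fint 𝒬 r ; (inj₂ (lift j)) → R j }
  ; qint = qint 𝒬
  }

data Relation (Ω : Set ℓ) : Set ℓ where
  foRel : (n : ℕ) → Subset Ω n → Relation Ω
  soRel : (k : ℕ) (t : Fin k → ℕ) → SORel Ω k t → Relation Ω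

Perm : Set ℓ → Set ℓ
Perm Ω = Ω ↔ Ω

-- g acting on a subset:  gS = { g ā : ā ∈ S },  i.e.  ā ∈ gS ⇔ g⁻¹ā ∈ S
act : {Ω : Set ℓ} → Perm Ω → {n : ℕ} → Subset Ω n → Subset Ω n
act g S as = S (map (Inverse.from g) as)

Preserves : {Ω : Set ℓ} → Perm Ω → Relation Ω → Set ℓ
Preserves g (foRel n R) = (as : Vec _ n) → act g R as ≡ R as
Preserves g (soRel k t Q) =
  (S : (j : Fin k) → Subset _ (t j)) → rel Q S ≡ rel Q (λ j → act g (S j))

IsAut : {Ω : Set ℓ} → Structure Ω → Perm Ω → Set ℓ
IsAut 𝒬 g =
  ((r : FSym (sig 𝒬)) → Preserves g (foRel _ (fint 𝒬 r))) Data.Product.×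
  ((q : QSym (sig 𝒬)) → Preserves g (soRel _ _ (qint 𝒬 q)))

InInvAut : {Ω : Set ℓ} → Structure Ω → Relation Ω → Set ℓ
InInvAut 𝒬 Q = (g : Perm _) → IsAut 𝒬 g → Preserves g Q

Definable : LEM ℓ → {Ω : Set ℓ} → Structure Ω → Relation Ω → Set (suc ℓ)
Definable {ℓ} lem {Ω} 𝒬 (foRel n R) =
  Σ (Formula (sig 𝒬) (Lift ℓ (Fin n))) λ φ →
    (as : Vec Ω n) → Sat lem 𝒬 φ (λ { (lift i) → lookup as i }) ⇔ (R as ≡ true)
Definable {ℓ} lem {Ω} 𝒬 (soRel k t Q) =
  Σ (Formula (expandSig (sig 𝒬) k t) ⊥) λ φ →
    (R : (j : Fin k) → Subset Ω (t j)) →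
      Sat lem (expand 𝒬 k t R) φ (λ ()) ⇔ (rel Q R ≡ true)

module Submission where

-- The proof uses the infinitary diagram of 𝒬.  Take one variable ȳ_c for
-- each element c ∈ Ω.  The formula  Diagram ȳ  says that c ↦ ȳ_c is a
-- bijection of Ω (a conjunction over all pairs c ≠ d, plus "every element
-- is some ȳ_c") which preserves every relation of 𝒬 (for each symbol and
-- each tuple, resp. each tuple of subsets, the literal with the correct
-- truth value).  Its satisfying assignments are exactly the automorphisms
-- of 𝒬 (diagram-sat).  A first-order R is then defined by
--   ∃ȳ (Diagram ȳ ∧ "x̄ ∈ ȳ[R]"),
-- and a second-order Q by
--   ∃ȳ (Diagram ȳ ∧ ⋁_{S ∈ Q} ⋀_j "P_j ∘ ȳ = S_j");
-- each holds iff the argument lies in the image of R, resp. of some member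
-- of Q, under some automorphism, which by invariance means it lies in R,
-- resp. in Q.

open import Level using (Level; Lift; lift; lower)
open import Data.Nat using (ℕ)
open import Data.Fin using (Fin)
open import Data.Bool using (Bool; true; false)
open import Data.Unit.Polymorphic using (⊤; tt)
open import Data.Vec using (Vec; map; lookup)
open import Data.Vec.Properties using (lookup-map; map-∘; map-id; map-cong; tabulate∘lookup; tabulate-cong)
open import Data.Sum using (_⊎_; inj₁; inj₂; [_,_])
open import Data.Product using (Σ; _,_; _×_; proj₁; proj₂)
open import Data.Empty using (⊥-elim)
import Data.Empty.Polymorphic as PE
open import Function using (_∘_; id)
open import Relation.Nullary using (yes; no)
open import Relation.Nullary.Decidable using (⌊_⌋)
open import Relation.Binary.PropositionalEquality using (_≡_; _≢_; refl; sym; trans; cong; module ≡-Reasoning)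
open import Function.Bundles using (_⇔_; Equivalence; Inverse; mk⇔; mk↔ₛ′)
open import Function.Construct.Identity using (↔-id)
import Function.Properties.Equivalence as ⇔
open import Data.Product.Function.NonDependent.Propositional using (_×-⇔_)
open import Function.Related.TypeIsomorphisms using (¬-cong-⇔)
open import Defs

open Equivalence using () renaming (to to forwards; from to backwards)
open Inverse using (strictlyInverseˡ; strictlyInverseʳ)

vec-ext : ∀ {a} {A : Set a} {n} (xs ys : Vec A n) →
          (∀ i → lookup xs i ≡ lookup ys i) → xs ≡ ys
vec-ext xs ys same = trans (sym (tabulate∘lookup xs))
                           (trans (tabulate-cong same) (tabulate∘lookup ys))

module Definability {ℓ : Level} (lem : LEM ℓ) {Ω : Set ℓ} where

  private
    variable
      W : Set ℓ
      n : ℕ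

  Π-⇔ : ∀ {a b} {I : Set ℓ} {A : I → Set a} {B : I → Set b} →
        (∀ i → A i ⇔ B i) → ((i : I) → A i) ⇔ ((i : I) → B i)
  Π-⇔ A⇔B = mk⇔ (λ f i → forwards (A⇔B i) (f i)) (λ f i → backwards (A⇔B i) (f i))

  Σ-⇔ : ∀ {a b} {I : Set ℓ} {A : I → Set a} {B : I → Set b} →
        (∀ i → A i ⇔ B i) → Σ I A ⇔ Σ I B
  Σ-⇔ A⇔B = mk⇔ (λ (i , a) → i , forwards (A⇔B i) a) (λ (i , b) → i , backwards (A⇔B i) b)

  ≡true-⇔ : {b c : Bool} → b ≡ c → (b ≡ true) ⇔ (c ≡ true)
  ≡true-⇔ refl = ⇔.refl

  decide-spec : (A : Set ℓ) → A ⇔ (⌊ lem A ⌋ ≡ true)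
  decide-spec A with lem A
  ... | yes a = mk⇔ (λ _ → refl) (λ _ → a)
  ... | no ¬a = mk⇔ (λ a → ⊥-elim (¬a a)) (λ ())

  decide-reflects : {A : Set ℓ} (b : Bool) → A ⇔ (b ≡ true) → ⌊ lem A ⌋ ≡ b
  decide-reflects {A} b A⇔b with lem A
  decide-reflects true  A⇔b | yes _  = refl
  decide-reflects false A⇔b | yes a  = sym (forwards A⇔b a)
  decide-reflects true  A⇔b | no  ¬a = ⊥-elim (¬a (backwards A⇔b refl))
  decide-reflects false A⇔b | no  _  = refl

  -- Equivalent propositions receive the same bit; this makes the semantics
  -- of generalized quantifiers invariant under equivalence of the operands.
  decide-cong : {A B : Set ℓ} → A ⇔ B → ⌊ lem A ⌋ ≡ ⌊ lem B ⌋
  decide-cong {B = B} A⇔B = decide-reflects _ (⇔.trans A⇔B (decide-spec B))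

  map-to-from : (g : Perm Ω) (as : Vec Ω n) → map (Inverse.to g) (map (Inverse.from g) as) ≡ as
  map-to-from g as = trans (sym (map-∘ _ _ as)) (trans (map-cong (strictlyInverseˡ g) as) (map-id as))

  map-from-to : (g : Perm Ω) (as : Vec Ω n) → map (Inverse.from g) (map (Inverse.to g) as) ≡ as
  map-from-to g as = trans (sym (map-∘ _ _ as)) (trans (map-cong (strictlyInverseʳ g) as) (map-id as))

  preserves-foRel : (g : Perm Ω) (S : Subset Ω n) →
    (∀ a → S (map (Inverse.to g) a) ≡ S a) ⇔ Preserves g (foRel n S)
  preserves-foRel g S = mk⇔
    (λ inv as → trans (sym (inv (map (Inverse.from g) as))) (cong S (map-to-from g as)))
    (λ inv a → trans (sym (inv (map (Inverse.to g) a))) (cong S (map-from-to g a)))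

  id-aut : (𝒮 : Structure Ω) → IsAut 𝒮 (↔-id Ω)
  id-aut 𝒮 = (λ r as → cong (fint 𝒮 r) (map-id as))
           , (λ q S → ext (qint 𝒮 q) _ _ (λ j as → cong (S j) (sym (map-id as))))

  lit : {τ : Signature ℓ} → Bool → Formula τ W → Formula τ W
  lit true  φ = φ
  lit false φ = neg φ

  lit-sat : (𝒮 : Structure Ω) (b : Bool) {c : Bool} (φ : Formula (sig 𝒮) W) (ρ : W → Ω) →
            Sat lem 𝒮 φ ρ ⇔ (c ≡ true) → Sat lem 𝒮 (lit b φ) ρ ⇔ (c ≡ b)
  lit-sat 𝒮 true          φ ρ φ⇔c = φ⇔c
  lit-sat 𝒮 false {false} φ ρ φ⇔c = mk⇔ (λ _ → refl) (λ _ s → false≢true (forwards φ⇔c s))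
    where false≢true : false ≢ true
          false≢true ()
  lit-sat 𝒮 false {true}  φ ρ φ⇔c = mk⇔ (λ ¬s → ⊥-elim (¬s (backwards φ⇔c refl))) (λ ())

  infixr 6 _∧_
  _∧_ : {τ : Signature ℓ} → Formula τ W → Formula τ W → Formula τ W
  φ ∧ ψ = conj (Lift ℓ Bool) λ { (lift true) → φ ; (lift false) → ψ }

  ∧-sat : {𝒮 : Structure Ω} {φ ψ : Formula (sig 𝒮) W} {ρ : W → Ω} →
          Sat lem 𝒮 (φ ∧ ψ) ρ ⇔ (Sat lem 𝒮 φ ρ × Sat lem 𝒮 ψ ρ)
  ∧-sat = mk⇔ (λ s → s (lift true) , s (lift false))
              (λ { (s , _) (lift true) → s ; (_ , s) (lift false) → s })

  PullbackIs : {τ : Signature ℓ} (r : FSym τ) → Subset Ω (far τ r) → (Ω → W) → Formula τ W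
  PullbackIs r S y = conj (Vec Ω _) λ a → lit (S a) (atom r (map y a))

  pullback-sat : (𝒮 : Structure Ω) (r : FSym (sig 𝒮)) (S : Subset Ω (far (sig 𝒮) r))
    (y : Ω → W) (ρ : W → Ω) (h : Ω → Ω) → (∀ c → ρ (y c) ≡ h c) →
    Sat lem 𝒮 (PullbackIs r S y) ρ ⇔ (∀ a → fint 𝒮 r (map h a) ≡ S a)
  pullback-sat 𝒮 r S y ρ h ρy≡h = Π-⇔ λ a → lit-sat 𝒮 (S a) _ ρ (atom-sat a)
    where
      atom-sat : ∀ a → Sat lem 𝒮 (atom r (map y a)) ρ ⇔ (fint 𝒮 r (map h a) ≡ true)
      atom-sat a = ⇔.trans (mk⇔ lower lift) (≡true-⇔ (cong (fint 𝒮 r)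
        (trans (sym (map-∘ ρ y a)) (map-cong ρy≡h a))))

  InImage : {τ : Signature ℓ} → Subset Ω n → (Fin n → W) → (Ω → W) → Formula τ W
  InImage {n = n} S x y =
    disj (Σ (Vec Ω n) λ a → S a ≡ true) λ (a , _) →
      conj (Lift ℓ (Fin n)) λ (lift i) → eq (x i) (y (lookup a i))

  inImage-sat : (𝒮 : Structure Ω) (S : Subset Ω n) (x : Fin n → W) (y : Ω → W)
    (ρ : W → Ω) (g : Perm Ω) → (∀ c → ρ (y c) ≡ Inverse.to g c) →
    (zs : Vec Ω n) → (∀ i → ρ (x i) ≡ lookup zs i) →
    Sat lem 𝒮 (InImage S x y) ρ ⇔ (act g S zs ≡ true)
  inImage-sat 𝒮 S x y ρ g ρy≡g zs ρx≡zs = mk⇔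
    (λ ((a , Sa) , x≡ya) → trans (cong S (vec-ext _ a (preimage a x≡ya))) Sa)
    (λ gSzs → (map from zs , gSzs) , λ (lift i) → image i)
    where
      open Inverse g using (to; from)
      open ≡-Reasoning
      preimage : ∀ a → (∀ (i : Lift ℓ (Fin _)) → ρ (x (lower i)) ≡ ρ (y (lookup a (lower i)))) →
                 ∀ i → lookup (map from zs) i ≡ lookup a i
      preimage a x≡ya i = begin
        lookup (map from zs) i  ≡⟨ lookup-map i from zs ⟩
        from (lookup zs i)      ≡⟨ cong from (sym (ρx≡zs i)) ⟩
        from (ρ (x i))          ≡⟨ cong from (x≡ya (lift i)) ⟩
        from (ρ (y (lookup a i))) ≡⟨ cong from (ρy≡g _) ⟩
        from (to (lookup a i))  ≡⟨ strictlyInverseʳ g _ ⟩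
        lookup a i              ∎
      image : ∀ i → ρ (x i) ≡ ρ (y (lookup (map from zs) i))
      image i = begin
        ρ (x i)                        ≡⟨ ρx≡zs i ⟩
        lookup zs i                    ≡⟨ sym (strictlyInverseˡ g _) ⟩
        to (from (lookup zs i))        ≡⟨ cong to (sym (lookup-map i from zs)) ⟩
        to (lookup (map from zs) i)    ≡⟨ sym (ρy≡g _) ⟩
        ρ (y (lookup (map from zs) i)) ∎

  Distinct : {τ : Signature ℓ} → (Ω → W) → Formula τ W
  Distinct y = conj (Σ Ω λ c → Σ Ω λ d → c ≢ d) (λ (c , d , _) → neg (eq (y c) (y d)))

  Onto : {τ : Signature ℓ} → (Ω → W) → Formula τ W
  Onto y = all ⊤ (disj Ω λ c → eq (inj₂ tt) (inj₁ (y c)))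

  Permutes : {τ : Signature ℓ} → (Ω → W) → Formula τ W
  Permutes y = Distinct y ∧ Onto y

  permutes-sat : (𝒮 : Structure Ω) (y : Ω → W) (ρ : W → Ω) →
    Sat lem 𝒮 (Permutes y) ρ ⇔ Σ (Perm Ω) λ g → ∀ c → ρ (y c) ≡ Inverse.to g c
  permutes-sat 𝒮 y ρ = mk⇔ (λ s → permutation (forwards ∧-sat s))
    (λ (g , ρy≡g) → backwards ∧-sat (distinct g ρy≡g , onto g ρy≡g))
    where
      distinct : (g : Perm Ω) → (∀ c → ρ (y c) ≡ Inverse.to g c) → Sat lem 𝒮 (Distinct y) ρ
      distinct g ρy≡g (c , d , c≢d) e = c≢d (begin
        c                               ≡⟨ sym (strictlyInverseʳ g c) ⟩
        Inverse.from g (Inverse.to g c) ≡⟨ cong (Inverse.from g) (trans (sym (ρy≡g c)) (trans e (ρy≡g d))) ⟩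
        Inverse.from g (Inverse.to g d) ≡⟨ strictlyInverseʳ g d ⟩
        d                               ∎)
        where open ≡-Reasoning
      onto : (g : Perm Ω) → (∀ c → ρ (y c) ≡ Inverse.to g c) → Sat lem 𝒮 (Onto y) ρ
      onto g ρy≡g τ = Inverse.from g (τ tt) , sym (trans (ρy≡g _) (strictlyInverseˡ g (τ tt)))
      -- conversely ρ ∘ y is injective and surjective, hence invertible
      permutation : Sat lem 𝒮 (Distinct y) ρ × Sat lem 𝒮 (Onto y) ρ →
                    Σ (Perm Ω) λ g → ∀ c → ρ (y c) ≡ Inverse.to g c
      permutation (distinct-sat , onto-sat) =
        mk↔ₛ′ (ρ ∘ y) preimage image-preimage preimage-image , λ _ → refl
        where
          preimage : Ω → Ω
          preimage z = proj₁ (onto-sat λ _ → z)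
          image-preimage : ∀ z → ρ (y (preimage z)) ≡ z
          image-preimage z = sym (proj₂ (onto-sat λ _ → z))
          ρy-injective : ∀ c d → ρ (y c) ≡ ρ (y d) → c ≡ d
          ρy-injective c d e with lem (c ≡ d)
          ... | yes c≡d = c≡d
          ... | no  c≢d = ⊥-elim (distinct-sat (c , d , c≢d) e)
          preimage-image : ∀ c → preimage (ρ (y c)) ≡ c
          preimage-image c = ρy-injective _ _ (image-preimage (ρ (y c)))

  embed : {σ : Signature ℓ} {k : ℕ} {t : Fin k → ℕ} → Formula σ W → Formula (expandSig σ k t) W
  embed (eq x y)    = eq x y
  embed (atom r xs) = atom (inj₁ r) xs
  embed (gq q φs)   = gq q (λ j → embed (φs j))
  embed (neg φ)     = neg (embed φ)
  embed (conj I φs) = conj I (λ i → embed (φs i))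
  embed (disj I φs) = disj I (λ i → embed (φs i))
  embed (ex J φ)    = ex J (embed φ)
  embed (all J φ)   = all J (embed φ)

  embed-sat : (𝒬 : Structure Ω) {k : ℕ} {t : Fin k → ℕ} (R : (j : Fin k) → Subset Ω (t j))
    (φ : Formula (sig 𝒬) W) (ρ : W → Ω) →
    Sat lem (expand 𝒬 k t R) (embed φ) ρ ⇔ Sat lem 𝒬 φ ρ
  embed-sat 𝒬 R (eq x y)    ρ = ⇔.refl
  embed-sat 𝒬 R (atom r xs) ρ = ⇔.refl
  embed-sat 𝒬 R (gq q φs)   ρ = mk⇔ (λ s → lift (trans (sym same) (lower s)))
                                    (λ s → lift (trans same (lower s)))
    where
      same : rel (qint 𝒬 q) (λ j as → ⌊ lem (Sat lem (expand 𝒬 _ _ R) (embed (φs j)) [ ρ , lookup as ]) ⌋)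
           ≡ rel (qint 𝒬 q) (λ j as → ⌊ lem (Sat lem 𝒬 (φs j) [ ρ , lookup as ]) ⌋)
      same = ext (qint 𝒬 q) _ _ λ j as → decide-cong (embed-sat 𝒬 R (φs j) [ ρ , lookup as ])
  embed-sat 𝒬 R (neg φ)     ρ = ¬-cong-⇔ (embed-sat 𝒬 R φ ρ)
  embed-sat 𝒬 R (conj I φs) ρ = Π-⇔ λ i → embed-sat 𝒬 R (φs i) ρ
  embed-sat 𝒬 R (disj I φs) ρ = Σ-⇔ λ i → embed-sat 𝒬 R (φs i) ρ
  embed-sat 𝒬 R (ex J φ)    ρ = Σ-⇔ λ τ → embed-sat 𝒬 R φ [ ρ , τ ]
  embed-sat 𝒬 R (all J φ)   ρ = Π-⇔ λ τ → embed-sat 𝒬 R φ [ ρ , τ ]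

  module _ (𝒬 : Structure Ω) where

    private
      σ : Signature ℓ
      σ = sig 𝒬

      Args : QSym σ → Set ℓ
      Args q = (j : Fin (qk σ q)) → Subset Ω (qt σ q j)

    Preserving : (Ω → W) → Formula σ W
    Preserving y =
      conj (FSym σ) (λ r → PullbackIs r (fint 𝒬 r) y)
      ∧ conj (Σ (QSym σ) Args) (λ (q , S) →
          lit (rel (qint 𝒬 q) S) (gq q λ j → InImage (S j) inj₂ (inj₁ ∘ y)))

    preserving-sat : (y : Ω → W) (ρ : W → Ω) (g : Perm Ω) → (∀ c → ρ (y c) ≡ Inverse.to g c) →
                     Sat lem 𝒬 (Preserving y) ρ ⇔ IsAut 𝒬 g
    preserving-sat y ρ g ρy≡g = ⇔.trans ∧-sat (relations ×-⇔ ⇔.trans (Π-⇔ quantifier) curried)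
      where
        relations : Sat lem 𝒬 (conj (FSym σ) (λ r → PullbackIs r (fint 𝒬 r) y)) ρ ⇔
                    ((r : FSym σ) → Preserves g (foRel _ (fint 𝒬 r)))
        relations = Π-⇔ λ r → ⇔.trans (pullback-sat 𝒬 r (fint 𝒬 r) y ρ (Inverse.to g) ρy≡g)
                                        (preserves-foRel g (fint 𝒬 r))
        image-sat : ∀ q (S : Args q) →
          Sat lem 𝒬 (gq q λ j → InImage (S j) inj₂ (inj₁ ∘ y)) ρ ⇔
          (rel (qint 𝒬 q) (λ j → act g (S j)) ≡ true)
        image-sat q S = ⇔.trans (mk⇔ lower lift) (≡true-⇔ (ext (qint 𝒬 q) _ _ λ j zs →
          decide-reflects _ (inImage-sat 𝒬 (S j) inj₂ (inj₁ ∘ y) [ ρ , lookup zs ] g ρy≡g zs (λ _ → refl))))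
        quantifier : ((q , S) : Σ (QSym σ) Args) →
          Sat lem 𝒬 (lit (rel (qint 𝒬 q) S) (gq q λ j → InImage (S j) inj₂ (inj₁ ∘ y))) ρ ⇔
          (rel (qint 𝒬 q) S ≡ rel (qint 𝒬 q) (λ j → act g (S j)))
        quantifier (q , S) = ⇔.trans (lit-sat 𝒬 (rel (qint 𝒬 q) S) _ ρ (image-sat q S)) (mk⇔ sym sym)
        curried : (((q , S) : Σ (QSym σ) Args) → rel (qint 𝒬 q) S ≡ rel (qint 𝒬 q) (λ j → act g (S j))) ⇔
                  ((q : QSym σ) → Preserves g (soRel _ _ (qint 𝒬 q)))
        curried = mk⇔ (λ p q S → p (q , S)) (λ p (q , S) → p q S)

    Diagram : (Ω → W) → Formula σ W
    Diagram y = Permutes y ∧ Preserving y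

    diagram-sat : (y : Ω → W) (ρ : W → Ω) →
      Sat lem 𝒬 (Diagram y) ρ ⇔ Σ (Perm Ω) λ g → (∀ c → ρ (y c) ≡ Inverse.to g c) × IsAut 𝒬 g
    diagram-sat y ρ = mk⇔
      (λ s → let (perm , pres) = forwards ∧-sat s
                 (g , ρy≡g)    = forwards (permutes-sat 𝒬 y ρ) perm
             in g , ρy≡g , forwards (preserving-sat y ρ g ρy≡g) pres)
      (λ (g , ρy≡g , aut) → backwards ∧-sat
        (backwards (permutes-sat 𝒬 y ρ) (g , ρy≡g) , backwards (preserving-sat y ρ g ρy≡g) aut))

    diagram-id : {V : Set ℓ} (ρ : V → Ω) → Sat lem 𝒬 (Diagram inj₂) [ ρ , id ]
    diagram-id ρ = backwards (diagram-sat inj₂ [ ρ , id ]) (↔-id Ω , (λ _ → refl) , id-aut 𝒬)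

    definable-foRel : (n : ℕ) (R : Subset Ω n) → InInvAut 𝒬 (foRel n R) → Definable lem 𝒬 (foRel n R)
    definable-foRel n R inv = φ , λ as → mk⇔ (sound as) (complete as)
      where
        x : Fin n → Lift ℓ (Fin n) ⊎ Ω
        x i = inj₁ (lift i)
        φ : Formula σ (Lift ℓ (Fin n))
        φ = ex Ω (Diagram inj₂ ∧ InImage R x inj₂)
        sound : ∀ as → Sat lem 𝒬 φ (lookup as ∘ lower) → R as ≡ true
        sound as (τ , s) =
          let (diag , image) = forwards ∧-sat s
              (g , τ≡g , aut) = forwards (diagram-sat inj₂ _) diag
          in trans (sym (inv g aut as))
                   (forwards (inImage-sat 𝒬 R x inj₂ [ lookup as ∘ lower , τ ] g τ≡g as (λ _ → refl)) image)
        complete : ∀ as → R as ≡ true → Sat lem 𝒬 φ (lookup as ∘ lower)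
        complete as Ras = id , backwards ∧-sat (diagram-id _ ,
          backwards (inImage-sat 𝒬 R x inj₂ [ lookup as ∘ lower , id ] (↔-id Ω) (λ _ → refl) as (λ _ → refl))
                    (trans (cong R (map-id as)) Ras))

    definable-soRel : (k : ℕ) (t : Fin k → ℕ) (Q : SORel Ω k t) →
                      InInvAut 𝒬 (soRel k t Q) → Definable lem 𝒬 (soRel k t Q)
    definable-soRel k t Q inv = φ , λ R → mk⇔ (sound R _) (complete R _)
      where
        P : Fin k → FSym (expandSig σ k t)
        P j = inj₂ (lift j)
        φ : Formula (expandSig σ k t) PE.⊥
        φ = ex Ω (embed (Diagram inj₂) ∧
              disj (Σ ((j : Fin k) → Subset Ω (t j)) λ S → rel Q S ≡ true) λ (S , _) →
                conj (Lift ℓ (Fin k)) λ (lift j) → PullbackIs (P j) (S j) inj₂)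
        sound : ∀ R (ρ : PE.⊥ → Ω) → Sat lem (expand 𝒬 k t R) φ ρ → rel Q R ≡ true
        sound R ρ (τ , s) with forwards ∧-sat s
        ... | diag , ((S , QS) , pullbacks)
            with forwards (diagram-sat inj₂ _) (forwards (embed-sat 𝒬 R (Diagram inj₂) _) diag)
        ... | g , τ≡g , aut = begin
          rel Q R                    ≡⟨ ext Q _ _ (λ j zs → trans (cong (R j) (sym (map-to-from g zs)))
                                                                  (R∘g≡S j _)) ⟩
          rel Q (λ j → act g (S j))  ≡⟨ sym (inv g aut S) ⟩
          rel Q S                    ≡⟨ QS ⟩
          true                       ∎
          where
            open ≡-Reasoning
            R∘g≡S : ∀ j a → R j (map (Inverse.to g) a) ≡ S j a
            R∘g≡S j = forwards (pullback-sat (expand 𝒬 k t R) (P j) (S j) inj₂ _ (Inverse.to g) τ≡g)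
                               (pullbacks (lift j))
        complete : ∀ R (ρ : PE.⊥ → Ω) → rel Q R ≡ true → Sat lem (expand 𝒬 k t R) φ ρ
        complete R ρ QR = id , backwards ∧-sat
          ( backwards (embed-sat 𝒬 R (Diagram inj₂) _) (diagram-id ρ)
          , (R , QR) , λ (lift j) → backwards (pullback-sat (expand 𝒬 k t R) (P j) (R j) inj₂ _ id (λ _ → refl))
                                               (λ a → cong (R j) (map-id a)))

lemma5 : {ℓ : Level} (lem : LEM ℓ) {Ω : Set ℓ} (𝒬 : Structure Ω) (Q : Relation Ω) →
           InInvAut 𝒬 Q → Definable lem 𝒬 Q
lemma5 lem 𝒬 (foRel n R)   = Definability.definable-foRel lem 𝒬 n R
lemma5 lem 𝒬 (soRel k t Q) = Definability.definable-soRel lem 𝒬 k t Q
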